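{- For every $m\ge0$, the sequence $a_m$ is $B(m)$-automatic, where $B(m)=2^{2^{K(m)}}$.
   Context: For $n\ge0$ write $b_p(n)=\lfloor n/2^p\rfloor\bmod 2$; $\oplus$ is XOR and $\&$ is bitwise AND. $a_m(n)=\bigoplus_{p\ge0,\ p\,\&\,m=0}b_p(n)$ and $K(m)=\max(1,\lceil\log_2(m+1)\rceil)$. A sequence $a$ is $k$-automatic if its $k$-kernel $\{n\mapsto a(k^en+r):e\ge0,\ 0\le r<k^e\}$ is finite. -}

module Defs where

open import Data.Bool using (Bool; false; true; _xor_; if_then_else_)
open import Data.Nat using (ℕ; zero; suc; _+_; _*_; _^_; _<_; _≡ᵇ_; _⊔_)
open import Data.Nat.DivMod using (_/_; _%_)
open import Data.Nat.Properties using (m^n≢0)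
open import Data.Nat.Logarithm using (⌈log₂_⌉)
open import Data.List using (List)
open import Data.List.Relation.Unary.Any using (Any)
open import Data.Product using (Σ)
open import Relation.Binary.PropositionalEquality using (_≡_)

b : ℕ → ℕ → ℕ
b p n = _/_ n (2 ^ p) {{m^n≢0 2 p}} % 2

bitB : ℕ → ℕ → Bool
bitB p n = b p n ≡ᵇ 1

-- bitwise AND  p & m = Σ_i 2^i b_i(p) b_i(m); bits i ≥ p of p vanish (p < 2^p)
andAux : ℕ → ℕ → ℕ → ℕ
andAux zero    p m = 0
andAux (suc i) p m = andAux i p m + 2 ^ i * (b i p * b i m)

_&_ : ℕ → ℕ → ℕ
p & m = andAux p p m

aAux : ℕ → ℕ → ℕ → Bool
aAux m zero    n = false
aAux m (suc p) n = if (p & m) ≡ᵇ 0 then bitB p n xor aAux m p n else aAux m p n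

-- a_m(n) = ⊕_{p ≥ 0, p & m = 0} b_p(n); b_p(n) = 0 for p ≥ n + 1 since n < 2^(n+1)
a : ℕ → ℕ → Bool
a m n = aAux m (suc n) n

K : ℕ → ℕ
K m = 1 ⊔ ⌈log₂ (suc m) ⌉

B : ℕ → ℕ
B m = 2 ^ (2 ^ K m)

-- k-automatic: the k-kernel {n ↦ s(k^e n + r) : e ≥ 0, 0 ≤ r < k^e} is finite,
-- i.e. contained (up to pointwise equality) in a finite list of sequences.
Automatic : ℕ → (ℕ → Bool) → Set
Automatic k s =
  Σ (List (ℕ → Bool)) λ L →
    (e r : ℕ) → r < k ^ e → Any (λ f → (n : ℕ) → s (k ^ e * n + r) ≡ f n) L

-- Bit p of n is untouched by adding multiples of 2^N when p < N, and p & m only depends on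
-- the K(m) low bits of p because m < 2^K(m). So the index set {p : p & m = 0} is invariant
-- under p ↦ 2^K(m)·e + p, and with N = 2^K(m)·e (so that B(m)^e = 2^N) the XOR defining
-- a_m(2^N n + r), r < 2^N, splits into the positions p < N, which only see r, and the
-- positions N + q, which see the bits of n exactly as a_m(n) does:
-- a_m(2^N n + r) = c ⊕ a_m(n) with c independent of n. The kernel is thus {a_m, ¬a_m}.
module Submission where

open import Defs
open import Data.Bool using (Bool; true; false; not; _xor_)
open import Data.Bool.Properties using (xor-assoc; xor-comm; xor-identityʳ)
open import Data.List using ([]; _∷_)
open import Data.List.Relation.Unary.Any using (Any; here; there)
open import Data.Nat.Base
open import Data.Nat.Divisibility using (divides)
open import Data.Nat.DivMod
open import Data.Nat.Induction using (<-wellFounded)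
open import Data.Nat.Logarithm using (⌈log₂_⌉)
open import Data.Nat.Logarithm.Core using (⌈log2⌉)
open import Data.Nat.Properties
open import Data.Nat.Solver using (module +-*-Solver)
open import Data.Product using (Σ; _,_)
open import Data.Sum using (inj₁; inj₂)
open import Function using (_∘_)
open import Induction.WellFounded using (Acc; acc)
open import Relation.Binary.PropositionalEquality

open +-*-Solver using (solve; _:=_; _:*_; con)

n<2^n : ∀ n → n < 2 ^ n
n<2^n zero    = s≤s z≤n
n<2^n (suc n) = begin-strict
  suc n           ≤⟨ n<2^n n ⟩
  2 ^ n           <⟨ m<m+n (2 ^ n) (m^n>0 2 n) ⟩
  2 ^ n + 2 ^ n   ≡⟨ cong (2 ^ n +_) (sym (+-identityʳ (2 ^ n))) ⟩
  2 ^ suc n       ∎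
  where open ≤-Reasoning

n≤2*⌈n/2⌉ : ∀ n → n ≤ 2 * ⌈ n /2⌉
n≤2*⌈n/2⌉ zero          = z≤n
n≤2*⌈n/2⌉ (suc zero)    = s≤s z≤n
n≤2*⌈n/2⌉ (suc (suc n)) = s≤s (begin
  suc n                     ≤⟨ s≤s (n≤2*⌈n/2⌉ n) ⟩
  suc (2 * ⌈ n /2⌉)         ≡⟨ sym (+-suc ⌈ n /2⌉ (⌈ n /2⌉ + 0)) ⟩
  ⌈ n /2⌉ + suc (⌈ n /2⌉ + 0) ∎)
  where open ≤-Reasoning

n≤2^⌈log2⌉n : ∀ n (rec : Acc _<_ n) → n ≤ 2 ^ ⌈log2⌉ n rec
n≤2^⌈log2⌉n zero          _        = z≤n
n≤2^⌈log2⌉n (suc zero)    _        = s≤s z≤n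
n≤2^⌈log2⌉n (suc (suc n)) (acc rs) =
  ≤-trans (n≤2*⌈n/2⌉ (suc (suc n)))
          (*-monoʳ-≤ 2 (n≤2^⌈log2⌉n (suc ⌈ n /2⌉) (rs (⌈n/2⌉<n n))))

m<2^K : ∀ m → m < 2 ^ K m
m<2^K m = ≤-trans (n≤2^⌈log2⌉n (suc m) (<-wellFounded (suc m)))
                  (^-monoʳ-≤ 2 (m≤n⊔m 1 ⌈log₂ (suc m) ⌉))

2^N*n+r<2^[N+k] : ∀ N k {n r} → r < 2 ^ N → n < 2 ^ k → 2 ^ N * n + r < 2 ^ (N + k)
2^N*n+r<2^[N+k] N k {n} {r} r<2^N n<2^k = begin-strict
  2 ^ N * n + r       <⟨ +-monoʳ-< (2 ^ N * n) r<2^N ⟩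
  2 ^ N * n + 2 ^ N   ≡⟨ trans (+-comm (2 ^ N * n) (2 ^ N)) (sym (*-suc (2 ^ N) n)) ⟩
  2 ^ N * suc n       ≤⟨ *-monoʳ-≤ (2 ^ N) n<2^k ⟩
  2 ^ N * 2 ^ k       ≡⟨ sym (^-distribˡ-+-* 2 N k) ⟩
  2 ^ (N + k)         ∎
  where open ≤-Reasoning

module _ (N : ℕ) where
  private instance
    2^N≢0 : NonZero (2 ^ N)
    2^N≢0 = m^n≢0 2 N

  [2^N*c+x]/2^N≡c+x/2^N : ∀ c x → (2 ^ N * c + x) / 2 ^ N ≡ c + x / 2 ^ N
  [2^N*c+x]/2^N≡c+x/2^N c x = begin
    (2 ^ N * c + x) / 2 ^ N        ≡⟨ /-congˡ (cong (_+ x) (*-comm (2 ^ N) c)) ⟩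
    (c * 2 ^ N + x) / 2 ^ N        ≡⟨ +-distrib-/-∣ˡ x (divides c refl) ⟩
    c * 2 ^ N / 2 ^ N + x / 2 ^ N  ≡⟨ cong (_+ x / 2 ^ N) (m*n/n≡m c (2 ^ N)) ⟩
    c + x / 2 ^ N                  ∎
    where open ≡-Reasoning

b-high : ∀ {i j x} → x < 2 ^ i → i ≤ j → b j x ≡ 0
b-high {j = j} x<2^i i≤j =
  cong (_% 2) (m<n⇒m/n≡0 {{m^n≢0 2 j}} (<-≤-trans x<2^i (^-monoʳ-≤ 2 i≤j)))

b-low : ∀ {j N} c x → j < N → b j (2 ^ N * c + x) ≡ b j x
b-low {j} c x j<N with m≤n⇒∃[o]m+o≡n j<N
... | d , refl = begin
  (2 ^ (suc j + d) * c + x) / 2 ^ j % 2         ≡⟨ cong (λ y → (y + x) / 2 ^ j % 2) 2^[1+j+d]*c≡2^j*k ⟩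
  (2 ^ j * (2 ^ d * c * 2) + x) / 2 ^ j % 2     ≡⟨ cong (_% 2) ([2^N*c+x]/2^N≡c+x/2^N j (2 ^ d * c * 2) x) ⟩
  (2 ^ d * c * 2 + x / 2 ^ j) % 2               ≡⟨ cong (_% 2) (+-comm (2 ^ d * c * 2) (x / 2 ^ j)) ⟩
  (x / 2 ^ j + 2 ^ d * c * 2) % 2               ≡⟨ [m+kn]%n≡m%n (x / 2 ^ j) (2 ^ d * c) 2 ⟩
  x / 2 ^ j % 2                                 ∎
  where
  open ≡-Reasoning
  instance
    2^j≢0 : NonZero (2 ^ j)
    2^j≢0 = m^n≢0 2 j
  2^[1+j+d]*c≡2^j*k : 2 ^ (suc j + d) * c ≡ 2 ^ j * (2 ^ d * c * 2)
  2^[1+j+d]*c≡2^j*k = begin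
    2 * 2 ^ (j + d) * c         ≡⟨ cong (λ y → 2 * y * c) (^-distribˡ-+-* 2 j d) ⟩
    2 * (2 ^ j * 2 ^ d) * c     ≡⟨ solve 3 (λ P Q C → con 2 :* (P :* Q) :* C := P :* (Q :* C :* con 2))
                                         refl (2 ^ j) (2 ^ d) c ⟩
    2 ^ j * (2 ^ d * c * 2)     ∎

b-shift : ∀ N q n {r} → r < 2 ^ N → b (N + q) (2 ^ N * n + r) ≡ b q n
b-shift N q n {r} r<2^N = cong (_% 2) (begin
  x / 2 ^ (N + q)        ≡⟨ /-congʳ (^-distribˡ-+-* 2 N q) ⟩
  x / (2 ^ N * 2 ^ q)    ≡⟨ sym (m/n/o≡m/[n*o] x (2 ^ N) (2 ^ q)) ⟩
  x / 2 ^ N / 2 ^ q      ≡⟨ cong (_/ 2 ^ q) ([2^N*c+x]/2^N≡c+x/2^N N n r) ⟩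
  (n + r / 2 ^ N) / 2 ^ q ≡⟨ cong (λ y → (n + y) / 2 ^ q) (m<n⇒m/n≡0 r<2^N) ⟩
  (n + 0) / 2 ^ q        ≡⟨ cong (_/ 2 ^ q) (+-identityʳ n) ⟩
  n / 2 ^ q              ∎)
  where
  open ≡-Reasoning
  instance
    2^N≢0 : NonZero (2 ^ N)
    2^N≢0 = m^n≢0 2 N
    2^q≢0 : NonZero (2 ^ q)
    2^q≢0 = m^n≢0 2 q
    2^[N+q]≢0 : NonZero (2 ^ (N + q))
    2^[N+q]≢0 = m^n≢0 2 (N + q)
    2^N*2^q≢0 : NonZero (2 ^ N * 2 ^ q)
    2^N*2^q≢0 = m*n≢0 (2 ^ N) (2 ^ q)
  x = 2 ^ N * n + r

andAux-congˡ : ∀ i {p p'} m → (∀ {j} → j < i → b j p ≡ b j p') → andAux i p m ≡ andAux i p' m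
andAux-congˡ zero    m _  = refl
andAux-congˡ (suc i) m eq =
  cong₂ (λ u v → u + 2 ^ i * (v * b i m)) (andAux-congˡ i m (eq ∘ m<n⇒m<1+n)) (eq (n<1+n i))

andAux-stable : ∀ {L i p m} → (∀ {j} → L ≤ j → b j p * b j m ≡ 0) → L ≤ i →
                andAux i p m ≡ andAux L p m
andAux-stable {L} {p = p} {m} tail≡0 L≤i with m≤n⇒∃[o]m+o≡n L≤i
... | d , refl = go d
  where
  go : ∀ d → andAux (L + d) p m ≡ andAux L p m
  go zero    = cong (λ i → andAux i p m) (+-identityʳ L)
  go (suc d) rewrite +-suc L d | tail≡0 (m≤m+n L d) | *-zeroʳ (2 ^ (L + d))
                   | +-identityʳ (andAux (L + d) p m) = go d

&≡andAux : ∀ N p m → m < 2 ^ N → p & m ≡ andAux N p m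
&≡andAux N p m m<2^N with ≤-total p N
... | inj₁ p≤N = sym (andAux-stable (λ {j} p≤j → cong (_* b j m) (b-high (n<2^n p) p≤j)) p≤N)
... | inj₂ N≤p = andAux-stable (λ {j} N≤j → trans (cong (b j p *_) (b-high m<2^N N≤j)) (*-zeroʳ (b j p))) N≤p

&-periodic : ∀ N c p m → m < 2 ^ N → (2 ^ N * c + p) & m ≡ p & m
&-periodic N c p m m<2^N = begin
  (2 ^ N * c + p) & m           ≡⟨ &≡andAux N (2 ^ N * c + p) m m<2^N ⟩
  andAux N (2 ^ N * c + p) m    ≡⟨ andAux-congˡ N m (b-low c p) ⟩
  andAux N p m                  ≡⟨ sym (&≡andAux N p m m<2^N) ⟩
  p & m                         ∎
  where open ≡-Reasoning

Selected : ℕ → ℕ → Bool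
Selected m p = (p & m) ≡ᵇ 0

Selected-periodic : ∀ m e q → Selected m (2 ^ K m * e + q) ≡ Selected m q
Selected-periodic m e q = cong (_≡ᵇ 0) (&-periodic (K m) e q m (m<2^K m))

aAux-congʳ : ∀ m P {x y} → (∀ {p} → p < P → b p x ≡ b p y) → aAux m P x ≡ aAux m P y
aAux-congʳ m zero    _  = refl
aAux-congʳ m (suc P) eq with Selected m P
... | true  = cong₂ (λ u v → (u ≡ᵇ 1) xor v) (eq (n<1+n P)) (aAux-congʳ m P (eq ∘ m<n⇒m<1+n))
... | false = aAux-congʳ m P (eq ∘ m<n⇒m<1+n)

aAux-stable : ∀ m {P Q x} → x < 2 ^ P → P ≤ Q → aAux m Q x ≡ aAux m P x
aAux-stable m {P} {x = x} x<2^P P≤Q with m≤n⇒∃[o]m+o≡n P≤Q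
... | d , refl = go d
  where
  go : ∀ d → aAux m (P + d) x ≡ aAux m P x
  go zero    = cong (λ Q → aAux m Q x) (+-identityʳ P)
  go (suc d) rewrite +-suc P d | b-high x<2^P (m≤m+n P d) | go d with Selected m (P + d)
  ... | true  = refl
  ... | false = refl

a≡aAux : ∀ m P {x} → x < 2 ^ P → a m x ≡ aAux m P x
a≡aAux m P {x} x<2^P = begin
  aAux m (suc x) x          ≡⟨ sym (aAux-stable m x<2^[1+x] (m≤n⊔m P (suc x))) ⟩
  aAux m (P ⊔ suc x) x      ≡⟨ aAux-stable m x<2^P (m≤m⊔n P (suc x)) ⟩
  aAux m P x                ∎
  where
  open ≡-Reasoning
  x<2^[1+x] : x < 2 ^ suc x
  x<2^[1+x] = <-≤-trans (n<2^n x) (^-monoʳ-≤ 2 (n≤1+n x))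

xor-left-comm : ∀ x y z → x xor (y xor z) ≡ y xor (x xor z)
xor-left-comm x y z = begin
  x xor (y xor z) ≡⟨ sym (xor-assoc x y z) ⟩
  (x xor y) xor z ≡⟨ cong (_xor z) (xor-comm x y) ⟩
  (y xor x) xor z ≡⟨ xor-assoc y x z ⟩
  y xor (x xor z) ∎
  where open ≡-Reasoning

aAux-+ : ∀ m N {x n} → (∀ q → b (N + q) x ≡ b q n) → (∀ q → Selected m (N + q) ≡ Selected m q) →
         ∀ Q → aAux m (N + Q) x ≡ aAux m N x xor aAux m Q n
aAux-+ m N {x} bits selected zero =
  trans (cong (λ P → aAux m P x) (+-identityʳ N)) (sym (xor-identityʳ _))
aAux-+ m N {x} {n} bits selected (suc Q)
  rewrite +-suc N Q | selected Q | bits Q | aAux-+ m N bits selected Q with Selected m Q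
... | true  = xor-left-comm (b Q n ≡ᵇ 1) (aAux m N x) (aAux m Q n)
... | false = refl

a-2^N*n+r : ∀ m N → (∀ q → Selected m (N + q) ≡ Selected m q) →
            ∀ {r} → r < 2 ^ N → ∀ n → a m (2 ^ N * n + r) ≡ aAux m N r xor a m n
a-2^N*n+r m N selected {r} r<2^N n = begin
  a m x                            ≡⟨ a≡aAux m (N + n) (2^N*n+r<2^[N+k] N n r<2^N (n<2^n n)) ⟩
  aAux m (N + n) x                 ≡⟨ aAux-+ m N (λ q → b-shift N q n r<2^N) selected n ⟩
  aAux m N x xor aAux m n n        ≡⟨ cong₂ _xor_ (aAux-congʳ m N (b-low n r)) (sym (a≡aAux m n (n<2^n n))) ⟩
  aAux m N r xor a m n             ∎
  where
  open ≡-Reasoning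
  x = 2 ^ N * n + r

Automatic-from-xor-kernel : ∀ k s →
  (∀ e r → r < k ^ e → Σ Bool λ c → ∀ n → s (k ^ e * n + r) ≡ c xor s n) → Automatic k s
Automatic-from-xor-kernel k s kernel = (s ∷ not ∘ s ∷ []) , λ e r r<k^e → member e r (kernel e r r<k^e)
  where
  member : ∀ e r → Σ Bool (λ c → ∀ n → s (k ^ e * n + r) ≡ c xor s n) →
           Any (λ f → ∀ n → s (k ^ e * n + r) ≡ f n) (s ∷ not ∘ s ∷ [])
  member e r (false , kernel≡s)  = here kernel≡s
  member e r (true  , kernel≡¬s) = there (here kernel≡¬s)

proposition10 : (m : ℕ) → Automatic (B m) (a m)
proposition10 m = Automatic-from-xor-kernel (B m) (a m) λ e r r<B^e →
  let N = 2 ^ K m * e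
      B^e≡2^N = ^-*-assoc 2 (2 ^ K m) e
  in aAux m N r , λ n → trans (cong (λ k → a m (k * n + r)) B^e≡2^N)
                              (a-2^N*n+r m N (Selected-periodic m e) (subst (r <_) B^e≡2^N r<B^e) n)
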